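{- Let $k\in\mathbb{Z}$ with $k\equiv 6 \pmod{12}$. Then $$\operatorname{Ker}\nu_{\eta^{2k}}=\left\{\begin{pmatrix} a&b\\ c&d\end{pmatrix}\in\Gamma(1)\;\Big|\;\begin{pmatrix} a&b\\ c&d\end{pmatrix}\equiv\begin{pmatrix} 1&0\\ 0&1\end{pmatrix},\begin{pmatrix} 0&1\\ 1&1\end{pmatrix},\begin{pmatrix} 1&1\\ 1&0\end{pmatrix}\pmod 2\right\}.$$ Moreover, the matrices $S^n$ $(n=0,1)$, where $S=\begin{pmatrix} 1&1\\ 0&1\end{pmatrix}$, form a complete set of coset representatives of $\Gamma(1)$ modulo $\operatorname{Ker}\nu_{\eta^{2k}}$.
   Context: Let $\Gamma(1)=SL(2,\mathbb{Z})$, acting on the upper half plane $\mathscr{H}=\{\tau\in\mathbb{C}:\Im\tau>0\}$ by $M\tau=\frac{a\tau+b}{c\tau+d}$ for $M=\begin{pmatrix} a&b\\ c&d\end{pmatrix}$. Let $\eta(\tau)=q^{1/24}\prod_{n\ge1}(1-q^n)$ with $q=e^{2\pi i\tau}$ and $q^{1/24}=e^{2\pi i\tau/24}$. For $m\in\mathbb{Z}$, the multiplier system $\nu_{\eta^{2m}}:\Gamma(1)\to\mathbb{C}^\times$ is defined by $\eta^{2m}(M\tau)=\nu_{\eta^{2m}}(M)(c\tau+d)^m\eta^{2m}(\tau)$ for all $\tau\in\mathscr{H}$; it is a character of $\Gamma(1)$, given explicitly by $\nu_{\eta^{2m}}(M)=\exp\{\frac{m\pi i}{6}f(M)\}$,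 where $f(M)=(a+d)c-bd(c^2-1)-3c$ if $c$ is odd and $f(M)=(a+d)c-bd(c^2-1)+3d-3-3cd$ if $c$ is even. $\operatorname{Ker}\nu_{\eta^{2m}}$ denotes its kernel. Congruences between integer matrices are entrywise. -}

module Defs where

open import Data.Nat using (ℕ; zero; suc)
import Data.Nat as ℕ
open import Data.Integer using (ℤ; +_; -_; _+_; _-_; _*_; ∣_∣)
open import Data.Integer.Divisibility using (_∣_)
open import Data.Fin using (Fin; zero; suc)
open import Data.Product using (Σ)
open import Relation.Binary.PropositionalEquality using (_≡_)

record Mat2 : Set where
  constructor mat
  field
    a b c d : ℤ
open Mat2 public

det : Mat2 → ℤ
det M = a M * d M - b M * c M

SL2 : Set
SL2 = Σ Mat2 (λ M → det M ≡ + 1)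

_·_ : Mat2 → Mat2 → Mat2
M · N = mat (a M * a N + b M * c N) (a M * b N + b M * d N)
            (c M * a N + d M * c N) (c M * b N + d M * d N)

-- inverse of a determinant-one matrix
inv : Mat2 → Mat2
inv M = mat (d M) (- b M) (- c M) (a M)

I₂ : Mat2
I₂ = mat (+ 1) (+ 0) (+ 0) (+ 1)

S : Mat2
S = mat (+ 1) (+ 1) (+ 0) (+ 1)

Spow : Fin 2 → Mat2
Spow zero = I₂
Spow (suc zero) = S

infix 4 _≡[_]_
_≡[_]_ : ℤ → ℤ → ℤ → Set
x ≡[ n ] y = n ∣ (x - y)

infix 4 _≡M2_
_≡M2_ : Mat2 → Mat2 → Set
M ≡M2 N = Σ (a M ≡[ + 2 ] a N) λ _ → Σ (b M ≡[ + 2 ] b N) λ _ →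
          Σ (c M ≡[ + 2 ] c N) λ _ → (d M ≡[ + 2 ] d N)

-- the exponent f(M) from the explicit formula for ν_{η^{2m}}
fOdd fEven : Mat2 → ℤ
fOdd M = (a M + d M) * c M - b M * d M * (c M * c M - + 1) - + 3 * c M
fEven M = (a M + d M) * c M - b M * d M * (c M * c M - + 1)
          + + 3 * d M - + 3 - + 3 * c M * d M

fAux : ℕ → Mat2 → ℤ
fAux zero M = fEven M
fAux (suc _) M = fOdd M

f : Mat2 → ℤ
f M = fAux (∣ c M ∣ ℕ.% 2) M

-- ν_{η^{2m}}(M) = exp(m π i f(M) / 6) = ζ₁₂^(m f(M)), ζ₁₂ = e^{2πi/12}.
-- Hence ν_{η^{2m}}(M) = 1 iff 12 ∣ m·f(M).
InKer : ℤ → Mat2 → Set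
InKer m M = + 12 ∣ (m * f M)

-- M and N lie in the same (right) coset Ker·N
SameCoset : ℤ → Mat2 → Mat2 → Set
SameCoset m M N = InKer m (M · inv N)

-- Since k/6 is odd, ν_{η^{2k}}(M) = exp(π i (k/6) f(M)) = (−1)^{f(M)}, so M lies in the kernel
-- iff f(M) is even.  On each branch f is an integer polynomial in the entries, and the branch is
-- chosen by the parity of c, so the parity of f(M) depends only on M mod 2.  The kernel is
-- therefore the preimage of a subset of SL(2, 𝔽₂), found by evaluating f on the six 0/1
-- representatives; the same finite computation exhibits I and S as coset representatives.
module Submission where

open import Defs
open import Data.Integer using (ℤ; +_; -[1+_]; -_; _+_; _-_; _*_; ∣_∣)
open import Data.Integer.Properties using (+-identityʳ)
open import Data.Integer.Divisibility.Signed
  using (_∣_; divides; ∣ᵤ⇒∣; ∣⇒∣ᵤ; ∣m∣n⇒∣m+n; ∣m∣n⇒∣m-n; ∣m+n∣m⇒∣n; ∣m⇒∣-m; ∣m⇒∣m*n; ∣n⇒∣m*n;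
         *-monoʳ-∣; *-cancelˡ-∣)
open import Data.Integer.DivMod using (_/ℕ_; a≡a%ℕn+[a/ℕn]*n)
open import Data.Integer.Tactic.RingSolver using (solve-∀)
open import Data.Nat using (ℕ; zero; suc; _%_)
open import Data.Nat.DivMod using (_mod_)
open import Data.Nat.Divisibility using (∣1⇒≡1)
open import Data.Fin using (Fin; toℕ)
open import Data.Fin.Patterns using (0F; 1F)
open import Data.Fin.Properties using (toℕ-fromℕ<)
open import Data.Product using (Σ; proj₁; proj₂; _×_; _,_)
open import Data.Sum using (_⊎_; inj₁; inj₂)
open import Data.Sum.Function.Propositional using (_⊎-⇔_)
open import Function.Base using (_∘_)
open import Function.Bundles using (_⇔_; mk⇔; Equivalence)
open import Function.Construct.Composition using (_⇔-∘_)
open import Function.Construct.Symmetry using (⇔-sym)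
open import Relation.Binary.PropositionalEquality
  using (_≡_; refl; sym; trans; cong; cong₂; subst; module ≡-Reasoning)

-- Congruence as a record over signed divisibility: Defs' _≡[_]_ unfolds to divisibility of
-- ∣ x - y ∣, from which Agda cannot infer x, y and n.
infix 4 _≈[_]_
record _≈[_]_ (x n y : ℤ) : Set where
  constructor mod-intro
  field
    divides-sub : n ∣ x - y
open _≈[_]_

≡[]⇔≈[] : ∀ {n} x y → x ≡[ n ] y ⇔ x ≈[ n ] y
≡[]⇔≈[] {n} x y = mk⇔ (mod-intro ∘ ∣ᵤ⇒∣ {n} {x - y}) (∣⇒∣ᵤ ∘ divides-sub)

module _ {n : ℤ} where

  private
    rearrange : ∀ {e x y} → e ≡ x - y → n ∣ e → x ≈[ n ] y
    rearrange refl = mod-intro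

  infixl 6 _⟨+⟩_ _⟨-⟩_
  infixl 7 _⟨*⟩_

  ≈-refl : ∀ {x} → x ≈[ n ] x
  ≈-refl {x} = rearrange (zero-sub x n) (divides (+ 0) refl)
    where
    zero-sub : ∀ x n → + 0 * n ≡ x - x
    zero-sub = solve-∀

  ⟨_⟩ : ∀ x → x ≈[ n ] x
  ⟨ _ ⟩ = ≈-refl

  ≈-sym : ∀ {x y} → x ≈[ n ] y → y ≈[ n ] x
  ≈-sym {x} {y} (mod-intro p) = rearrange (neg-sub x y) (∣m⇒∣-m p)
    where
    neg-sub : ∀ x y → - (x - y) ≡ y - x
    neg-sub = solve-∀

  ≈-trans : ∀ {x y z} → x ≈[ n ] y → y ≈[ n ] z → x ≈[ n ] z
  ≈-trans {x} {y} {z} (mod-intro p) (mod-intro q) = rearrange (telescope x y z) (∣m∣n⇒∣m+n p q)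
    where
    telescope : ∀ x y z → (x - y) + (y - z) ≡ x - z
    telescope = solve-∀

  _⟨+⟩_ : ∀ {x y u v} → x ≈[ n ] y → u ≈[ n ] v → x + u ≈[ n ] y + v
  _⟨+⟩_ {x} {y} {u} {v} (mod-intro p) (mod-intro q) = rearrange (sub-+ x y u v) (∣m∣n⇒∣m+n p q)
    where
    sub-+ : ∀ x y u v → (x - y) + (u - v) ≡ (x + u) - (y + v)
    sub-+ = solve-∀

  _⟨-⟩_ : ∀ {x y u v} → x ≈[ n ] y → u ≈[ n ] v → x - u ≈[ n ] y - v
  _⟨-⟩_ {x} {y} {u} {v} (mod-intro p) (mod-intro q) = rearrange (sub-- x y u v) (∣m∣n⇒∣m-n p q)
    where
    sub-- : ∀ x y u v → (x - y) - (u - v) ≡ (x - u) - (y - v)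
    sub-- = solve-∀

  _⟨*⟩_ : ∀ {x y u v} → x ≈[ n ] y → u ≈[ n ] v → x * u ≈[ n ] y * v
  _⟨*⟩_ {x} {y} {u} {v} (mod-intro p) (mod-intro q) =
    rearrange (sub-* x y u v) (∣m∣n⇒∣m+n (∣m⇒∣m*n u p) (∣n⇒∣m*n y q))
    where
    sub-* : ∀ x y u v → (x - y) * u + y * (u - v) ≡ x * u - y * v
    sub-* = solve-∀

  ∣⇔≈0 : ∀ x → (n ∣ x) ⇔ x ≈[ n ] + 0
  ∣⇔≈0 x = mk⇔ (mod-intro ∘ subst (n ∣_) (sym (+-identityʳ x)))
               (subst (n ∣_) (+-identityʳ x) ∘ divides-sub)

residue : ℤ → Fin 2
residue x = ∣ x ∣ mod 2

toℕ-residue : ∀ x → toℕ (residue x) ≡ ∣ x ∣ % 2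
toℕ-residue x = toℕ-fromℕ< _

x≈∣x∣ : ∀ x → x ≈[ + 2 ] + ∣ x ∣
x≈∣x∣ (+ _) = ≈-refl
x≈∣x∣ -[1+ m ] = mod-intro (divides -[1+ m ] (neg-sub-self (+ suc m)))
  where
  neg-sub-self : ∀ y → - y - y ≡ (- y) * + 2
  neg-sub-self = solve-∀

m≈m%2 : ∀ m → + m ≈[ + 2 ] + (m % 2)
m≈m%2 m = ≈-sym (mod-intro (divides (- q) (begin
  + r - + m                  ≡⟨ cong (λ z → + r - z) (a≡a%ℕn+[a/ℕn]*n (+ m) 2) ⟩
  + r - (+ r + q * + 2)      ≡⟨ sub-add (+ r) q ⟩
  (- q) * + 2                ∎)))
  where
  open ≡-Reasoning
  r : ℕ
  r = m % 2
  q : ℤ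
  q = + m /ℕ 2
  sub-add : ∀ r q → r - (r + q * + 2) ≡ (- q) * + 2
  sub-add = solve-∀

x≈residue : ∀ x → x ≈[ + 2 ] + toℕ (residue x)
x≈residue x = subst (λ r → x ≈[ + 2 ] + r) (sym (toℕ-residue x)) (≈-trans (x≈∣x∣ x) (m≈m%2 ∣ x ∣))

+toℕ-injective-mod2 : ∀ (i j : Fin 2) → + toℕ i ≈[ + 2 ] + toℕ j → i ≡ j
+toℕ-injective-mod2 0F 0F _ = refl
+toℕ-injective-mod2 1F 1F _ = refl
+toℕ-injective-mod2 0F 1F (mod-intro 2∣-1) with () ← ∣1⇒≡1 (∣⇒∣ᵤ 2∣-1)
+toℕ-injective-mod2 1F 0F (mod-intro 2∣1) with () ← ∣1⇒≡1 (∣⇒∣ᵤ 2∣1)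

residue-cong : ∀ {x y} → x ≈[ + 2 ] y → residue x ≡ residue y
residue-cong {x} {y} x≈y = +toℕ-injective-mod2 (residue x) (residue y)
  (≈-trans (≈-sym (x≈residue x)) (≈-trans x≈y (x≈residue y)))

≈₂⇔residue≡ : ∀ x y → x ≈[ + 2 ] y ⇔ residue x ≡ residue y
≈₂⇔residue≡ x y = mk⇔ residue-cong λ eq →
  ≈-trans (x≈residue x) (subst (λ i → + toℕ i ≈[ + 2 ] y) (sym eq) (≈-sym (x≈residue y)))

2∣⇔residue≡0 : ∀ x → (+ 2 ∣ x) ⇔ residue x ≡ 0F
2∣⇔residue≡0 x = ≈₂⇔residue≡ x (+ 0) ⇔-∘ ∣⇔≈0 x

12∣k*x⇔2∣x : ∀ {k} x → k ≈[ + 12 ] + 6 → (+ 12 ∣ k * x) ⇔ (+ 2 ∣ x)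
12∣k*x⇔2∣x {k} x (mod-intro 12∣k-6) =
  mk⇔ (*-cancelˡ-∣ (+ 6)) (*-monoʳ-∣ (+ 6)) ⇔-∘ mk⇔ to from
  where
  split : ∀ k x → k * x ≡ (k - + 6) * x + + 6 * x
  split = solve-∀
  12∣[k-6]x : + 12 ∣ (k - + 6) * x
  12∣[k-6]x = ∣m⇒∣m*n x 12∣k-6
  to : + 12 ∣ k * x → + 12 ∣ + 6 * x
  to 12∣kx = ∣m+n∣m⇒∣n (subst (+ 12 ∣_) (split k x) 12∣kx) 12∣[k-6]x
  from : + 12 ∣ + 6 * x → + 12 ∣ k * x
  from 12∣6x = subst (+ 12 ∣_) (sym (split k x)) (∣m∣n⇒∣m+n 12∣[k-6]x 12∣6x)

infix 4 _≈₂_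
record _≈₂_ (M N : Mat2) : Set where
  constructor entrywise
  field
    a≈ : a M ≈[ + 2 ] a N
    b≈ : b M ≈[ + 2 ] b N
    c≈ : c M ≈[ + 2 ] c N
    d≈ : d M ≈[ + 2 ] d N
open _≈₂_

≈₂-refl : ∀ {M} → M ≈₂ M
≈₂-refl = entrywise ≈-refl ≈-refl ≈-refl ≈-refl

·-cong : ∀ {M M′ N N′} → M ≈₂ M′ → N ≈₂ N′ → M · N ≈₂ M′ · N′
·-cong (entrywise a b c d) (entrywise a′ b′ c′ d′) =
  entrywise (a ⟨*⟩ a′ ⟨+⟩ b ⟨*⟩ c′) (a ⟨*⟩ b′ ⟨+⟩ b ⟨*⟩ d′)
            (c ⟨*⟩ a′ ⟨+⟩ d ⟨*⟩ c′) (c ⟨*⟩ b′ ⟨+⟩ d ⟨*⟩ d′)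

det-cong : ∀ {M N} → M ≈₂ N → det M ≈[ + 2 ] det N
det-cong (entrywise a b c d) = a ⟨*⟩ d ⟨-⟩ b ⟨*⟩ c

fOdd-cong : ∀ {M N} → M ≈₂ N → fOdd M ≈[ + 2 ] fOdd N
fOdd-cong (entrywise a b c d) = (a ⟨+⟩ d) ⟨*⟩ c ⟨-⟩ b ⟨*⟩ d ⟨*⟩ (c ⟨*⟩ c ⟨-⟩ ⟨ + 1 ⟩) ⟨-⟩ ⟨ + 3 ⟩ ⟨*⟩ c

fEven-cong : ∀ {M N} → M ≈₂ N → fEven M ≈[ + 2 ] fEven N
fEven-cong (entrywise a b c d) =
  (a ⟨+⟩ d) ⟨*⟩ c ⟨-⟩ b ⟨*⟩ d ⟨*⟩ (c ⟨*⟩ c ⟨-⟩ ⟨ + 1 ⟩) ⟨+⟩ ⟨ + 3 ⟩ ⟨*⟩ d ⟨-⟩ ⟨ + 3 ⟩ ⟨-⟩ ⟨ + 3 ⟩ ⟨*⟩ c ⟨*⟩ d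

f-cong : ∀ {M N} → M ≈₂ N → f M ≈[ + 2 ] f N
f-cong {M} {N} M≈N = subst (λ r → f M ≈[ + 2 ] fAux r N) ∣c∣%2-cong (fAux-cong (∣ c M ∣ % 2))
  where
  fAux-cong : ∀ r → fAux r M ≈[ + 2 ] fAux r N
  fAux-cong zero = fEven-cong M≈N
  fAux-cong (suc _) = fOdd-cong M≈N
  ∣c∣%2-cong : ∣ c M ∣ % 2 ≡ ∣ c N ∣ % 2
  ∣c∣%2-cong = trans (sym (toℕ-residue (c M))) (trans (cong toℕ (residue-cong (c≈ M≈N))) (toℕ-residue (c N)))

Mat𝔽₂ : Set
Mat𝔽₂ = Fin 2 × Fin 2 × Fin 2 × Fin 2

reduce : Mat2 → Mat𝔽₂
reduce M = residue (a M) , residue (b M) , residue (c M) , residue (d M)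

lift : Mat𝔽₂ → Mat2
lift (i , j , k , l) = mat (+ toℕ i) (+ toℕ j) (+ toℕ k) (+ toℕ l)

≈₂-lift-reduce : ∀ M → M ≈₂ lift (reduce M)
≈₂-lift-reduce M = entrywise (x≈residue (a M)) (x≈residue (b M)) (x≈residue (c M)) (x≈residue (d M))

≡M2⇔reduce≡ : ∀ M N → M ≡M2 N ⇔ reduce M ≡ reduce N
≡M2⇔reduce≡ M N = mk⇔ reduce≡ ≡M2
  where
  entry⇔ : ∀ x y → x ≡[ + 2 ] y ⇔ residue x ≡ residue y
  entry⇔ x y = ≈₂⇔residue≡ x y ⇔-∘ ≡[]⇔≈[] x y
  entry⇒ : ∀ x y → x ≡[ + 2 ] y → residue x ≡ residue y
  entry⇒ x y = Equivalence.to (entry⇔ x y)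
  entry⇐ : ∀ x y → residue x ≡ residue y → x ≡[ + 2 ] y
  entry⇐ x y = Equivalence.from (entry⇔ x y)
  reduce≡ : M ≡M2 N → reduce M ≡ reduce N
  reduce≡ (a≡ , b≡ , c≡ , d≡) =
    cong₂ _,_ (entry⇒ (a M) (a N) a≡) (cong₂ _,_ (entry⇒ (b M) (b N) b≡)
      (cong₂ _,_ (entry⇒ (c M) (c N) c≡) (entry⇒ (d M) (d N) d≡)))
  ≡M2 : reduce M ≡ reduce N → M ≡M2 N
  ≡M2 eq = entry⇐ (a M) (a N) (cong proj₁ eq) , entry⇐ (b M) (b N) (cong (proj₁ ∘ proj₂) eq) ,
           entry⇐ (c M) (c N) (cong (proj₁ ∘ proj₂ ∘ proj₂) eq) , entry⇐ (d M) (d N) (cong (proj₂ ∘ proj₂ ∘ proj₂) eq)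

det-lift-reduce≡1 : ∀ ((M , _) : SL2) → residue (det (lift (reduce M))) ≡ 1F
det-lift-reduce≡1 (M , det≡1) = trans (sym (residue-cong (det-cong (≈₂-lift-reduce M)))) (cong residue det≡1)

InKer⇔residue-f≡0 : ∀ k {M N} → k ≡[ + 12 ] + 6 → M ≈₂ N → InKer k M ⇔ residue (f N) ≡ 0F
InKer⇔residue-f≡0 k {M} k≡6 M≈N = subst (λ r → InKer k M ⇔ r ≡ 0F) (residue-cong (f-cong M≈N))
  (2∣⇔residue≡0 (f M)
    ⇔-∘ (12∣k*x⇔2∣x (f M) (Equivalence.to (≡[]⇔≈[] k (+ 6)) k≡6)
    ⇔-∘ mk⇔ (∣ᵤ⇒∣ {+ 12} {k * f M}) ∣⇒∣ᵤ))

SameCoset⇔residue-f≡0 : ∀ k M N → k ≡[ + 12 ] + 6 → SameCoset k M N ⇔ residue (f (lift (reduce M) · inv N)) ≡ 0F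
SameCoset⇔residue-f≡0 k M N k≡6 =
  InKer⇔residue-f≡0 k {M · inv N} {lift (reduce M) · inv N} k≡6 (·-cong (≈₂-lift-reduce M) ≈₂-refl)

kernel-mod2 : ∀ B → residue (det (lift B)) ≡ 1F →
  residue (f (lift B)) ≡ 0F ⇔ (B ≡ (1F , 0F , 0F , 1F) ⊎ B ≡ (0F , 1F , 1F , 1F) ⊎ B ≡ (1F , 1F , 1F , 0F))
kernel-mod2 B det≡1 = mk⇔ (listed B det≡1) even
  where
  listed : ∀ B → residue (det (lift B)) ≡ 1F → residue (f (lift B)) ≡ 0F →
    B ≡ (1F , 0F , 0F , 1F) ⊎ B ≡ (0F , 1F , 1F , 1F) ⊎ B ≡ (1F , 1F , 1F , 0F)
  listed (0F , 0F , 0F , 0F) () _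
  listed (0F , 0F , 0F , 1F) () _
  listed (0F , 0F , 1F , 0F) () _
  listed (0F , 0F , 1F , 1F) () _
  listed (0F , 1F , 0F , 0F) () _
  listed (0F , 1F , 0F , 1F) () _
  listed (0F , 1F , 1F , 0F) _ ()
  listed (0F , 1F , 1F , 1F) _ _ = inj₂ (inj₁ refl)
  listed (1F , 0F , 0F , 0F) () _
  listed (1F , 0F , 0F , 1F) _ _ = inj₁ refl
  listed (1F , 0F , 1F , 0F) () _
  listed (1F , 0F , 1F , 1F) _ ()
  listed (1F , 1F , 0F , 0F) () _
  listed (1F , 1F , 0F , 1F) _ ()
  listed (1F , 1F , 1F , 0F) _ _ = inj₂ (inj₂ refl)
  listed (1F , 1F , 1F , 1F) () _
  even : B ≡ (1F , 0F , 0F , 1F) ⊎ B ≡ (0F , 1F , 1F , 1F) ⊎ B ≡ (1F , 1F , 1F , 0F) → residue (f (lift B)) ≡ 0F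
  even (inj₁ refl) = refl
  even (inj₂ (inj₁ refl)) = refl
  even (inj₂ (inj₂ refl)) = refl

coset-mod2 : ∀ B → residue (det (lift B)) ≡ 1F → Σ (Fin 2) λ n → residue (f (lift B · inv (Spow n))) ≡ 0F
coset-mod2 (0F , 0F , 0F , 0F) ()
coset-mod2 (0F , 0F , 0F , 1F) ()
coset-mod2 (0F , 0F , 1F , 0F) ()
coset-mod2 (0F , 0F , 1F , 1F) ()
coset-mod2 (0F , 1F , 0F , 0F) ()
coset-mod2 (0F , 1F , 0F , 1F) ()
coset-mod2 (0F , 1F , 1F , 0F) _ = 1F , refl
coset-mod2 (0F , 1F , 1F , 1F) _ = 0F , refl
coset-mod2 (1F , 0F , 0F , 0F) ()
coset-mod2 (1F , 0F , 0F , 1F) _ = 0F , refl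
coset-mod2 (1F , 0F , 1F , 0F) ()
coset-mod2 (1F , 0F , 1F , 1F) _ = 1F , refl
coset-mod2 (1F , 1F , 0F , 0F) ()
coset-mod2 (1F , 1F , 0F , 1F) _ = 1F , refl
coset-mod2 (1F , 1F , 1F , 0F) _ = 0F , refl
coset-mod2 (1F , 1F , 1F , 1F) ()

Spow-distinct-mod2 : ∀ n n′ → residue (f (Spow n · inv (Spow n′))) ≡ 0F → n ≡ n′
Spow-distinct-mod2 0F 0F _ = refl
Spow-distinct-mod2 1F 1F _ = refl
Spow-distinct-mod2 0F 1F ()
Spow-distinct-mod2 1F 0F ()

InKer⇔≡M2-listed : ∀ k → k ≡[ + 12 ] + 6 → (M : SL2) → InKer k (proj₁ M) ⇔
  (proj₁ M ≡M2 mat (+ 1) (+ 0) (+ 0) (+ 1)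
    ⊎ proj₁ M ≡M2 mat (+ 0) (+ 1) (+ 1) (+ 1)
    ⊎ proj₁ M ≡M2 mat (+ 1) (+ 1) (+ 1) (+ 0))
InKer⇔≡M2-listed k k≡6 M@(M₀ , _) =
  ⇔-sym (≡M2⇔reduce≡ M₀ (mat (+ 1) (+ 0) (+ 0) (+ 1))
          ⊎-⇔ ≡M2⇔reduce≡ M₀ (mat (+ 0) (+ 1) (+ 1) (+ 1))
          ⊎-⇔ ≡M2⇔reduce≡ M₀ (mat (+ 1) (+ 1) (+ 1) (+ 0)))
  ⇔-∘ (kernel-mod2 (reduce M₀) (det-lift-reduce≡1 M) ⇔-∘ InKer⇔residue-f≡0 k k≡6 (≈₂-lift-reduce M₀))

SameCoset-Spow-exists : ∀ k → k ≡[ + 12 ] + 6 → (M : SL2) → Σ (Fin 2) λ n → SameCoset k (proj₁ M) (Spow n)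
SameCoset-Spow-exists k k≡6 M@(M₀ , _) =
  let n , even = coset-mod2 (reduce M₀) (det-lift-reduce≡1 M)
  in n , Equivalence.from (SameCoset⇔residue-f≡0 k M₀ (Spow n) k≡6) even

SameCoset-Spow-injective : ∀ k → k ≡[ + 12 ] + 6 → (n n′ : Fin 2) → SameCoset k (Spow n) (Spow n′) → n ≡ n′
SameCoset-Spow-injective k k≡6 n n′ same =
  Spow-distinct-mod2 n n′ (Equivalence.to (InKer⇔residue-f≡0 k k≡6 (≈₂-refl {Spow n · inv (Spow n′)})) same)

mainTheorem2 : (k : ℤ) → k ≡[ + 12 ] + 6 →
    ((M : SL2) → InKer k (proj₁ M) ⇔
      (proj₁ M ≡M2 mat (+ 1) (+ 0) (+ 0) (+ 1)
        ⊎ proj₁ M ≡M2 mat (+ 0) (+ 1) (+ 1) (+ 1)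
        ⊎ proj₁ M ≡M2 mat (+ 1) (+ 1) (+ 1) (+ 0)))
    × ((M : SL2) → Σ (Fin 2) (λ n → SameCoset k (proj₁ M) (Spow n)))
    × ((n n′ : Fin 2) → SameCoset k (Spow n) (Spow n′) → n ≡ n′)
mainTheorem2 k k≡6 = InKer⇔≡M2-listed k k≡6 , SameCoset-Spow-exists k k≡6 , SameCoset-Spow-injective k k≡6
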